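{- Let $n$ be an odd integer and let $k\geq 3$ be a divisor of $n$. Then there exist at least $\Phi(k)+1$ simple cyclic $(nk,k)_n$ relative Heffter systems, where $\Phi$ is Euler's totient function.
   Context: Let $G$ be an abelian group of order $2nk+t$ and $J$ a subgroup of order $t$. A half-set of $G\setminus J$ is a subset $V$ of size $nk$ with $V\cup(-V)=G\setminus J$. An $(nk,k)_t$ relative Heffter system on $V$ is a partition of $V$ into blocks of size $k$, each summing to $0$ in $G$. It is cyclic if $G=\mathbb{Z}_{2nk+t}$ and $J$ is its subgroup of order $t$ (so here $G=\mathbb{Z}_{n(2k+1)}$ and $J=\langle 2k+1\rangle$). A $k$-subset $B$ is simple if its elements admit an ordering $(b_0,\dots,b_{k-1})$ whose partial sums $c_i=\sum_{j=0}^{i}b_j$ are pairwise distinct; a relative Heffter system is simple if each block is simple. -}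

module Defs where

open import Data.Nat using (ℕ; zero; suc; _+_; _*_; _∸_; _%_; _≤_; NonZero; ≢-nonZero)
open import Data.Nat.Divisibility using (_∣_; _∣0)
open import Data.Nat.Properties using (m*n≢0; m+1+n≢0)
open import Data.Empty using (⊥-elim)
open import Data.Nat.Coprimality using (Coprime; coprime?)
open import Data.Fin using (Fin; toℕ)
open import Data.Fin.Subset using (Subset; _∈_; _∉_; ∣_∣)
open import Data.Vec using (lookup)
open import Data.Bool using (if_then_else_)
open import Data.List using (List; []; _∷_; length; filter; map; upTo; allFin)
open import Data.Nat.ListAction using (sum)
open import Data.List.Membership.Propositional renaming (_∈_ to _∈ˡ_)
open import Data.List.Relation.Unary.Unique.Propositional using (Unique)
open import Data.List.Relation.Unary.AllPairs using (AllPairs)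
open import Data.Product using (Σ; ∃; _×_; _,_)
open import Data.Sum using (_⊎_)
open import Function.Bundles using (_⇔_)
open import Relation.Binary.PropositionalEquality using (_≡_)
open import Relation.Nullary using (¬_)

φ : ℕ → ℕ
φ k = length (filter (λ i → coprime? i k) (map suc (upTo k)))

Odd : ℕ → Set
Odd n = ¬ (2 ∣ n)

oddNZ : (n k : ℕ) → Odd n → NonZero (n * (2 * k + 1))
oddNZ zero k o = ⊥-elim (o (2 ∣0))
oddNZ (suc m) k o = m*n≢0 (suc m) (2 * k + 1) {{_}} {{≢-nonZero (m+1+n≢0 (2 * k) {0})}}

-- Ambient cyclic group ℤ_N, N = n(2k+1), elements Fin N, arithmetic mod N
module Cyclic (n k : ℕ) (oddn : Odd n) where

  instance
    N-nonZero : NonZero (n * (2 * k + 1))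
    N-nonZero = oddNZ n k oddn

  N : ℕ
  N = n * (2 * k + 1)

  G : Set
  G = Fin N

  -- the subgroup J of order n: multiples of 2k+1
  InJ : G → Set
  InJ x = (2 * k + 1) ∣ toℕ x

  negℕ : G → ℕ
  negℕ x = (N ∸ toℕ x) % N

  -- membership of the element with residue r (r < N assumed) in a subset
  _∈ᴺ_ : ℕ → Subset N → Set
  r ∈ᴺ V = Σ G (λ y → (toℕ y ≡ r) × (y ∈ V))

  IsHalfSet : Subset N → Set
  IsHalfSet V = (∣ V ∣ ≡ n * k) × (∀ (x : G) → ((¬ InJ x) ⇔ ((x ∈ V) ⊎ (negℕ x ∈ᴺ V))))

  subsetSum : Subset N → ℕ
  subsetSum B = sum (map (λ x → if lookup B x then toℕ x else 0) (allFin N)) % N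

  partialSums : ℕ → List G → List ℕ
  partialSums acc [] = []
  partialSums acc (b ∷ bs) = ((acc + toℕ b) % N) ∷ partialSums (acc + toℕ b) bs

  IsSimple : Subset N → Set
  IsSimple B = ∃ λ (l : List G) →
    Unique l × (∀ x → (x ∈ˡ l) ⇔ (x ∈ B)) × Unique (partialSums 0 l)

  -- an (nk,k)_n relative Heffter system on a half-set V, blocks given as subsets
  record RelHeffter : Set where
    field
      V        : Subset N
      halfSet  : IsHalfSet V
      blocks   : List (Subset N)
      blockSize : ∀ B → B ∈ˡ blocks → ∣ B ∣ ≡ k
      blockSum  : ∀ B → B ∈ˡ blocks → subsetSum B ≡ 0
      covers    : ∀ x → x ∈ V → ∃ λ B → (B ∈ˡ blocks) × (x ∈ B)
      inside    : ∀ B → B ∈ˡ blocks → ∀ x → x ∈ B → x ∈ V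
      disjoint  : ∀ B C → B ∈ˡ blocks → C ∈ˡ blocks → ∀ x → x ∈ B → x ∈ C → B ≡ C

  open RelHeffter public

  IsSimpleSystem : RelHeffter → Set
  IsSimpleSystem H = ∀ B → B ∈ˡ blocks H → IsSimple B

  SameSystem : RelHeffter → RelHeffter → Set
  SameSystem H H' = ∀ B → (B ∈ˡ blocks H) ⇔ (B ∈ˡ blocks H')

  Distinct : RelHeffter → RelHeffter → Set
  Distinct H H' = ¬ SameSystem H H'

{-# OPTIONS --safe #-}
-- Write k = 2s + 1 and p = 2k + 1.  First a base sequence r₀, …, r_(k−1) of nonzero residues mod p is
-- built that meets every pair {v, −v} of ℤ_p ∖ {0} once, sums to 0 and has pairwise distinct partial
-- sums: its partial sums walk through 1, −(1 + e₁), 2, −(2 + e₂), …, s, −(s + e_s), 0, where the shift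
-- e_m vanishes up to a threshold and is constant beyond it (threshold and constant depend on s mod 2).
-- This block is then lifted to ℤ_(np): the t-th system has, for every q ∈ ℤ_n, the block of elements
-- p (c_i q + o_i(t)) + r_i.  The coefficients c_i are units of ℤ_n summing to 0 and the offsets o_i(t)
-- absorb the carry of Σ r_i, so every block sums to 0; its partial sums are distinct already mod p; and
-- as q ↦ c_i q + o_i(t) is a bijection of ℤ_n, the blocks partition a half-set of ℤ_(np) ∖ pℤ_(np).
-- The n systems t = 0, …, n − 1 differ in the block through p · 0 + r₀, and n ≥ k > φ(k).
module Submission where

open import Defs
open import Data.Nat using (ℕ; _+_; _≤_)
open import Data.Nat.Divisibility using (_∣_)
open import Data.Product using (∃; _×_)
open import Data.List using (List; length)
open import Data.List.Relation.Unary.All using (All)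
open import Data.List.Relation.Unary.AllPairs using (AllPairs)

open import Data.Bool using (true; false; if_then_else_; _∨_)
open import Data.Empty using (⊥-elim)
open import Data.Fin as Fin using (Fin; toℕ; fromℕ<; punchOut; combine; opposite)
import Data.Fin.Properties as Finₚ
open import Data.Fin.Subset using (Subset; ∣_∣) renaming (_∈_ to _∈ˢ_)
open import Data.List using ([]; _∷_; map; tabulate; applyUpTo; allFin; upTo; concat)
import Data.List.Properties as Listₚ
import Data.List.Membership.DecPropositional as DecMembership
open import Data.List.Membership.Propositional using (_∈_)
import Data.List.Membership.Propositional.Properties as ∈ₚ
import Data.List.Relation.Unary.All as All
import Data.List.Relation.Unary.All.Properties as Allₚ
import Data.List.Relation.Unary.AllPairs as AllPairs
import Data.List.Relation.Unary.AllPairs.Properties as AllPairsₚ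
import Data.List.Relation.Unary.Any as Any
open import Data.List.Relation.Unary.AllPairs using ([]; _∷_)
open import Data.List.Relation.Unary.Unique.Propositional using (Unique)
import Data.List.Relation.Unary.Unique.Propositional.Properties as Uniqueₚ
open import Data.Nat using (zero; suc; pred; _*_; _∸_; _<_; _%_; _/_; NonZero; ≢-nonZero; >-nonZero; z≤n; s≤s; _≤?_; _<?_)
open import Data.Nat.Coprimality as Coprimality using (Coprime; coprime?; coprime-divisor; coprime-+; 1-coprimeTo)
open import Data.Nat.DivMod
open import Data.Nat.Divisibility
  using (divides; _∣0; ∣-refl; ∣-trans; ∣⇒≤; ∣m+n∣m⇒∣n; n∣m*n; m∣m*n; m%n≡0⇒n∣m; n∣m⇒m%n≡0)
open import Data.Nat.ListAction using (sum)
open import Data.Nat.Primality using (irreducible[2])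
open import Data.Nat.Properties
open import Data.Nat.Solver using (module +-*-Solver)
open import Algebra.Properties.CommutativeSemigroup +-commutativeSemigroup using (interchange)
open import Data.Product using (_,_; proj₁; proj₂; map₂)
open import Data.Sum as Sum using (_⊎_; inj₁; inj₂)
open import Data.Vec as Vec using (lookup)
open import Data.Vec.Properties using (lookup∘tabulate; []=⇒lookup; lookup⇒[]=)
open import Function using (_∘_; const)
open import Function.Bundles using (_⇔_; mk⇔; Equivalence)
open import Function.Definitions using (Injective; StrictlySurjective)
open import Relation.Binary using (tri<; tri≈; tri>)
open import Relation.Binary.PropositionalEquality
open import Relation.Nullary using (¬_; does; yes; no)
open import Relation.Nullary.Decidable using (dec-true; dec-false)
open +-*-Solver

-- Doubling, parity and interleaving

double : ℕ → ℕ
double zero = zero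
double (suc m) = suc (suc (double m))

double≡2* : ∀ m → double m ≡ 2 * m
double≡2* zero = refl
double≡2* (suc m) = trans (cong (2 +_) (double≡2* m)) (sym (*-suc 2 m))

double≡+ : ∀ m → double m ≡ m + m
double≡+ zero = refl
double≡+ (suc m) = cong suc (trans (cong suc (double≡+ m)) (sym (+-suc m m)))

m≤double : ∀ m → m ≤ double m
m≤double m = subst (m ≤_) (sym (double≡+ m)) (m≤m+n m m)

double-mono-≤ : ∀ {a b} → a ≤ b → double a ≤ double b
double-mono-≤ z≤n = z≤n
double-mono-≤ (s≤s a≤b) = s≤s (s≤s (double-mono-≤ a≤b))

double-mono-< : ∀ {a b} → a < b → double a < double b
double-mono-< (s≤s a≤b) = s≤s (m≤n⇒m≤1+n (double-mono-≤ a≤b))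

double-cancel-≤ : ∀ {a b} → double a ≤ double b → a ≤ b
double-cancel-≤ {zero} _ = z≤n
double-cancel-≤ {suc a} {suc b} (s≤s (s≤s le)) = s≤s (double-cancel-≤ le)

double-cancel-< : ∀ {a b} → double a < double b → a < b
double-cancel-< {zero} {suc b} _ = s≤s z≤n
double-cancel-< {suc a} {suc b} (s≤s (s≤s lt)) = s≤s (double-cancel-< lt)

data Parity : ℕ → Set where
  even : ∀ m → Parity (double m)
  odd  : ∀ m → Parity (suc (double m))

parity : ∀ i → Parity i
parity zero = even zero
parity (suc i) with parity i
... | even m = odd m
... | odd m  = even (suc m)

odd⇒3+double : ∀ {k} → 3 ≤ k → ¬ 2 ∣ k → ∃ λ j → k ≡ 3 + double j
odd⇒3+double {k} 3≤k 2∤k with parity k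
... | even m = ⊥-elim (2∤k (divides m (trans (double≡2* m) (*-comm 2 m))))
... | odd zero = ⊥-elim (<⇒≱ 3≤k (s≤s z≤n))
... | odd (suc j) = j , refl

interleave : {A : Set} → (ℕ → A) → (ℕ → A) → ℕ → A
interleave f g zero = f zero
interleave f g (suc i) = interleave g (f ∘ suc) i

interleave-even : {A : Set} (f g : ℕ → A) (m : ℕ) → interleave f g (double m) ≡ f m
interleave-even f g zero = refl
interleave-even f g (suc m) = interleave-even (f ∘ suc) (g ∘ suc) m

interleave-odd : {A : Set} (f g : ℕ → A) (m : ℕ) → interleave f g (suc (double m)) ≡ g m
interleave-odd f g m = interleave-even g (f ∘ suc) m

m+n≡o⇒o∸m≡n : ∀ {m n o} → m + n ≡ o → o ∸ m ≡ n
m+n≡o⇒o∸m≡n {m} {n} refl = m+n∸m≡n m n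

reflect-in-interval : ∀ {l m h} → l < m → m ≤ h → ∃ λ m′ → l < m′ × m′ ≤ h × m + m′ ≡ suc (l + h)
reflect-in-interval {l} {m} {h} l<m m≤h with a , refl ← m≤n⇒∃[o]m+o≡n l<m | b , refl ← m≤n⇒∃[o]m+o≡n m≤h =
  suc l + b , s≤s (m≤m+n l b) , +-monoˡ-≤ b (m≤m+n (suc l) a) ,
  solve 3 (λ l a b → con 1 :+ l :+ a :+ (con 1 :+ l :+ b) := con 1 :+ (l :+ (con 1 :+ l :+ a :+ b))) refl l a b

strictlyIncreasing⇒injective : ∀ {f : ℕ → ℕ} → (∀ {x y} → x < y → f x < f y) → Injective _≡_ _≡_ f
strictlyIncreasing⇒injective {f} increasing {x} {y} fx≡fy with <-cmp x y
... | tri< x<y _ _ = ⊥-elim (<-irrefl fx≡fy (increasing x<y))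
... | tri≈ _ x≡y _ = x≡y
... | tri> _ _ y<x = ⊥-elim (<-irrefl (sym fx≡fy) (increasing y<x))

applyUpTo-cong : ∀ {A : Set} {f g : ℕ → A} m → (∀ {i} → i < m → f i ≡ g i) → applyUpTo f m ≡ applyUpTo g m
applyUpTo-cong zero _ = refl
applyUpTo-cong (suc m) f≗g = cong₂ _∷_ (f≗g (s≤s z≤n)) (applyUpTo-cong m (λ i<m → f≗g (s≤s i<m)))

length-concat-map : ∀ {A B : Set} (f : A → List B) {m} → (∀ x → length (f x) ≡ m) →
  ∀ xs → length (concat (map f xs)) ≡ length xs * m
length-concat-map f f-length [] = refl
length-concat-map f f-length (x ∷ xs) =
  trans (Listₚ.length-++ (f x)) (cong₂ _+_ (f-length x) (length-concat-map f f-length xs))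

sum-applyUpTo-0 : ∀ m → sum (applyUpTo (λ _ → 0) m) ≡ 0
sum-applyUpTo-0 zero = refl
sum-applyUpTo-0 (suc m) = sum-applyUpTo-0 m

sum-applyUpTo-suc : ∀ (f : ℕ → ℕ) m → sum (applyUpTo f (suc m)) ≡ sum (applyUpTo f m) + f m
sum-applyUpTo-suc f zero = +-comm (f 0) 0
sum-applyUpTo-suc f (suc m) = trans (cong (f 0 +_) (sum-applyUpTo-suc (f ∘ suc) m)) (sym (+-assoc (f 0) _ _))

sum-applyUpTo-linear : ∀ c (f g : ℕ → ℕ) m →
  sum (applyUpTo (λ i → c * f i + g i) m) ≡ c * sum (applyUpTo f m) + sum (applyUpTo g m)
sum-applyUpTo-linear c f g zero = sym (trans (+-identityʳ (c * 0)) (*-zeroʳ c))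
sum-applyUpTo-linear c f g (suc m) = begin
  c * f 0 + g 0 + sum (applyUpTo (λ i → c * f (suc i) + g (suc i)) m)
    ≡⟨ cong (c * f 0 + g 0 +_) (sum-applyUpTo-linear c (f ∘ suc) (g ∘ suc) m) ⟩
  c * f 0 + g 0 + (c * sum (applyUpTo (f ∘ suc) m) + sum (applyUpTo (g ∘ suc) m))
    ≡⟨ solve 5 (λ c a b x y → c :* a :+ b :+ (c :* x :+ y) := c :* (a :+ x) :+ (b :+ y)) refl c (f 0) (g 0) _ _ ⟩
  c * (f 0 + sum (applyUpTo (f ∘ suc) m)) + (g 0 + sum (applyUpTo (g ∘ suc) m)) ∎
  where open ≡-Reasoning

-- Arithmetic modulo n

toℕ-mod : ∀ m n .{{_ : NonZero n}} → toℕ (m mod n) ≡ m % n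
toℕ-mod m n = Finₚ.toℕ-fromℕ< (m%n<n m n)

[m%d+n]%d≡[m+n]%d : ∀ m n d .{{_ : NonZero d}} → (m % d + n) % d ≡ (m + n) % d
[m%d+n]%d≡[m+n]%d m n d = begin
  (m % d + n) % d            ≡⟨ %-distribˡ-+ (m % d) n d ⟩
  (m % d % d + n % d) % d    ≡⟨ cong (λ x → (x + n % d) % d) (m%n%n≡m%n m d) ⟩
  (m % d + n % d) % d        ≡⟨ sym (%-distribˡ-+ m n d) ⟩
  (m + n) % d ∎
  where open ≡-Reasoning

sum-applyUpTo-% : ∀ (f : ℕ → ℕ) m n .{{_ : NonZero n}} →
  sum (applyUpTo (λ i → f i % n) m) % n ≡ sum (applyUpTo f m) % n
sum-applyUpTo-% f zero n = refl
sum-applyUpTo-% f (suc m) n = begin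
  (f 0 % n + sum (applyUpTo (λ i → f (suc i) % n) m)) % n
    ≡⟨ %-distribˡ-+ (f 0 % n) _ n ⟩
  (f 0 % n % n + sum (applyUpTo (λ i → f (suc i) % n) m) % n) % n
    ≡⟨ cong₂ (λ a b → (a + b) % n) (m%n%n≡m%n (f 0) n) (sum-applyUpTo-% (f ∘ suc) m n) ⟩
  (f 0 % n + sum (applyUpTo (f ∘ suc) m) % n) % n
    ≡⟨ sym (%-distribˡ-+ (f 0) _ n) ⟩
  (f 0 + sum (applyUpTo (f ∘ suc) m)) % n ∎
  where open ≡-Reasoning

[m+d]%n≡m%n⇒n∣d : ∀ m d n .{{_ : NonZero n}} → (m + d) % n ≡ m % n → n ∣ d
[m+d]%n≡m%n⇒n∣d m d n eq = ∣m+n∣m⇒∣n (subst (n ∣_) (sym quotients) (n∣m*n ((m + d) / n))) (n∣m*n (m / n))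
  where
  open ≡-Reasoning
  quotients : m / n * n + d ≡ (m + d) / n * n
  quotients = +-cancelˡ-≡ (m % n) _ _ (begin
    m % n + (m / n * n + d)        ≡⟨ sym (+-assoc (m % n) _ d) ⟩
    m % n + m / n * n + d          ≡⟨ cong (_+ d) (sym (m≡m%n+[m/n]*n m n)) ⟩
    m + d                          ≡⟨ m≡m%n+[m/n]*n (m + d) n ⟩
    (m + d) % n + (m + d) / n * n  ≡⟨ cong (_+ (m + d) / n * n) eq ⟩
    m % n + (m + d) / n * n ∎)

[x*c+a]%n-injective : ∀ {n c x y} a .{{_ : NonZero n}} → Coprime n c → x < n → y < n →
  (x * c + a) % n ≡ (y * c + a) % n → x ≡ y
[x*c+a]%n-injective {n} {c} {x} {y} a cop x<n y<n eq =
  Sum.[ (λ x≤y → sym (cancel x≤y y<n (sym eq))) , (λ y≤x → cancel y≤x x<n eq) ]′ (≤-total x y)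
  where
  cancel : ∀ {u v} → u ≤ v → v < n → (v * c + a) % n ≡ (u * c + a) % n → v ≡ u
  cancel {u} {v} u≤v v<n e = begin
    v       ≡⟨ sym (m+[n∸m]≡n u≤v) ⟩
    u + d   ≡⟨ cong (u +_) d≡0 ⟩
    u + 0   ≡⟨ +-identityʳ u ⟩
    u ∎
    where
    open ≡-Reasoning
    d : ℕ
    d = v ∸ u
    shifted : (u * c + a + d * c) % n ≡ (u * c + a) % n
    shifted = trans (cong (_% n) (begin
      u * c + a + d * c  ≡⟨ solve 4 (λ u a d c → u :* c :+ a :+ d :* c := (u :+ d) :* c :+ a) refl u a d c ⟩
      (u + d) * c + a    ≡⟨ cong (λ w → w * c + a) (m+[n∸m]≡n u≤v) ⟩
      v * c + a ∎)) e
    n∣d : n ∣ d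
    n∣d = coprime-divisor cop (subst (n ∣_) (*-comm d c) ([m+d]%n≡m%n⇒n∣d (u * c + a) (d * c) n shifted))
    d≡0 : d ≡ 0
    d≡0 = trans (sym (m<n⇒m%n≡m (≤-<-trans (m∸n≤m v u) v<n))) (n∣m⇒m%n≡0 d n n∣d)

odd⇒coprime-2 : ∀ {n} → ¬ 2 ∣ n → Coprime n 2
odd⇒coprime-2 2∤n (d∣n , d∣2) with irreducible[2] d∣2
... | inj₁ d≡1 = d≡1
... | inj₂ refl = ⊥-elim (2∤n d∣n)

coprime-pred : ∀ m → Coprime (suc m) m
coprime-pred m = subst (λ n → Coprime n m) (+-comm m 1) (coprime-+ (1-coprimeTo m))

¬coprime-self : ∀ {m} → 2 ≤ m → ¬ Coprime m m
¬coprime-self 2≤m cop = <⇒≢ 2≤m (sym (cop (∣-refl , ∣-refl)))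

φ<n : ∀ {n} → 2 ≤ n → φ n < n
φ<n {suc m} 2≤n = subst (φ (suc m) <_) (trans (Listₚ.length-map suc (upTo (suc m))) (Listₚ.length-upTo (suc m)))
  (Listₚ.filter-notAll (λ i → coprime? i (suc m)) (map suc (upTo (suc m)))
    (Any.map (λ { refl → ¬coprime-self 2≤n }) (∈ₚ.∈-map⁺ suc (∈ₚ.∈-upTo⁺ (n<1+n m)))))

-- Endomaps of a finite set

injective⇒surjective : ∀ {m} {f : Fin m → Fin m} → Injective _≡_ _≡_ f → StrictlySurjective _≡_ f
injective⇒surjective {suc m} {f} inj y with Finₚ.any? (λ x → f x Finₚ.≟ y)
... | yes hit = hit
... | no miss = ⊥-elim (<-irrefl refl (Finₚ.injective⇒≤ avoid-injective))
  where
  y≢f : ∀ x → y ≢ f x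
  y≢f x y≡fx = miss (x , sym y≡fx)
  avoid : Fin (suc m) → Fin m
  avoid x = punchOut (y≢f x)
  avoid-injective : Injective _≡_ _≡_ avoid
  avoid-injective {a} {b} eq = inj (Finₚ.punchOut-injective (y≢f a) (y≢f b) eq)

surjective⇒injective : ∀ {m} {f : Fin m → Fin m} → StrictlySurjective _≡_ f → Injective _≡_ _≡_ f
surjective⇒injective {f = f} surj {x} {y} fx≡fy =
  trans (sym (section-retraction x)) (trans (cong section fx≡fy) (section-retraction y))
  where
  section : _ → _
  section z = proj₁ (surj z)
  section-injective : Injective _≡_ _≡_ section
  section-injective {a} {b} eq = trans (sym (proj₂ (surj a))) (trans (cong f eq) (proj₂ (surj b)))
  section-retraction : ∀ z → section (f z) ≡ z
  section-retraction z with w , sw≡z ← injective⇒surjective section-injective z =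
    trans (cong section (trans (cong f (sym sw≡z)) (proj₂ (surj w)))) sw≡z

sum-map-+ : ∀ {A : Set} (f g : A → ℕ) xs → sum (map (λ x → f x + g x) xs) ≡ sum (map f xs) + sum (map g xs)
sum-map-+ f g [] = refl
sum-map-+ f g (x ∷ xs) = trans (cong (f x + g x +_) (sum-map-+ f g xs)) (interchange (f x) (g x) _ _)

sum-map-0 : ∀ {A : Set} (xs : List A) → sum (map (const 0) xs) ≡ 0
sum-map-0 [] = refl
sum-map-0 (_ ∷ xs) = sum-map-0 xs

sum-map-allFin-suc : ∀ {N} (f : Fin (suc N) → ℕ) →
  sum (map f (allFin (suc N))) ≡ f Fin.zero + sum (map (f ∘ Fin.suc) (allFin N))
sum-map-allFin-suc f = cong (λ xs → f Fin.zero + sum xs)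
  (trans (Listₚ.map-tabulate Fin.suc f) (sym (Listₚ.map-tabulate (λ x → x) (f ∘ Fin.suc))))

sum-indicator : ∀ {N} (f : Fin N → ℕ) (a : Fin N) →
  sum (map (λ x → if does (x Finₚ.≟ a) then f x else 0) (allFin N)) ≡ f a
sum-indicator {suc N} f Fin.zero =
  trans (sum-map-allFin-suc (λ x → if does (x Finₚ.≟ Fin.zero) then f x else 0))
        (trans (cong (f Fin.zero +_) (sum-map-0 (allFin N))) (+-identityʳ _))
sum-indicator {suc N} f (Fin.suc a) =
  trans (sum-map-allFin-suc (λ x → if does (x Finₚ.≟ Fin.suc a) then f x else 0)) (sum-indicator (f ∘ Fin.suc) a)

sumOver : ∀ {N} → Subset N → (Fin N → ℕ) → ℕ
sumOver S f = sum (map (λ x → if lookup S x then f x else 0) (allFin _))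

∣∣≡sumOver-1 : ∀ {N} (S : Subset N) → ∣ S ∣ ≡ sumOver S (const 1)
∣∣≡sumOver-1 Vec.[] = refl
∣∣≡sumOver-1 (b Vec.∷ S) = trans (head b) (sym (sum-map-allFin-suc (λ x → if lookup (b Vec.∷ S) x then 1 else 0)))
  where
  head : ∀ b → ∣ b Vec.∷ S ∣ ≡ (if b then 1 else 0) + sumOver S (const 1)
  head true = cong suc (∣∣≡sumOver-1 S)
  head false = ∣∣≡sumOver-1 S

module _ {N : ℕ} where
  open DecMembership (Finₚ._≟_ {N}) using (_∈?_)

  fromList : List (Fin N) → Subset N
  fromList xs = Vec.tabulate (λ x → does (x ∈? xs))

  ∈-fromList : ∀ {x} xs → x ∈ˢ fromList xs ⇔ x ∈ xs
  ∈-fromList {x} xs = mk⇔ to (λ x∈ → lookup⇒[]= x _ (trans (lookup∘tabulate _ x) (dec-true (x ∈? xs) x∈)))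
    where
    to : x ∈ˢ fromList xs → x ∈ xs
    to x∈S with x ∈? xs | trans (sym (lookup∘tabulate _ x)) ([]=⇒lookup x∈S)
    ... | yes x∈ | _ = x∈
    ... | no _ | ()

  sumOver-fromList : ∀ (f : Fin N → ℕ) {xs} → Unique xs → sumOver (fromList xs) f ≡ sum (map f xs)
  sumOver-fromList f {xs} u =
    trans (cong sum (Listₚ.map-cong (λ x → cong (λ b → if b then f x else 0) (lookup∘tabulate _ x)) (allFin N))) (go u)
    where
    go : ∀ {xs} → Unique xs → sum (map (λ x → if does (x ∈? xs) then f x else 0) (allFin N)) ≡ sum (map f xs)
    go [] = sum-map-0 (allFin N)
    go {a ∷ xs} u@(_ ∷ u′) = begin
      sum (map (λ x → if does (x Finₚ.≟ a) ∨ does (x ∈? xs) then f x else 0) (allFin N))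
        ≡⟨ cong sum (Listₚ.map-cong split (allFin N)) ⟩
      sum (map (λ x → [x≡a] x + [x∈xs] x) (allFin N))
        ≡⟨ sum-map-+ [x≡a] [x∈xs] (allFin N) ⟩
      sum (map [x≡a] (allFin N)) + sum (map [x∈xs] (allFin N))
        ≡⟨ cong₂ _+_ (sum-indicator f a) (go u′) ⟩
      f a + sum (map f xs) ∎
      where
      open ≡-Reasoning
      [x≡a] [x∈xs] : Fin N → ℕ
      [x≡a] x = if does (x Finₚ.≟ a) then f x else 0
      [x∈xs] x = if does (x ∈? xs) then f x else 0
      split : ∀ x → (if does (x Finₚ.≟ a) ∨ does (x ∈? xs) then f x else 0) ≡ [x≡a] x + [x∈xs] x
      split x with x Finₚ.≟ a
      ... | yes refl rewrite dec-false (x ∈? xs) (Uniqueₚ.Unique[x∷xs]⇒x∉xs u) = sym (+-identityʳ (f x))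
      ... | no _ = refl

  ∣fromList∣ : ∀ {xs} → Unique xs → ∣ fromList xs ∣ ≡ length xs
  ∣fromList∣ {xs} u = trans (∣∣≡sumOver-1 (fromList xs)) (trans (sumOver-fromList (const 1) u) (sum-map-1 xs))
    where
    sum-map-1 : ∀ {A : Set} (ys : List A) → sum (map (const 1) ys) ≡ length ys
    sum-map-1 [] = refl
    sum-map-1 (_ ∷ ys) = cong suc (sum-map-1 ys)

-- Base sequences in ℤ_(2k+1)

infix 4 _≡±_mod_
_≡±_mod_ : ℕ → ℕ → ℕ → Set
x ≡± v mod p = x ≡ v ⊎ x + v ≡ p

≡±-complement : ∀ {a v p} → a ≤ p → a ≡± v mod p → p ∸ a ≡± v mod p
≡±-complement a≤p (inj₁ refl) = inj₂ (m∸n+n≡m a≤p)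
≡±-complement a≤p (inj₂ a+v≡p) = inj₁ (m+n≡o⇒o∸m≡n a+v≡p)

2k+1-nonZero : ∀ k → NonZero (2 * k + 1)
2k+1-nonZero k = ≢-nonZero (m+1+n≢0 (2 * k))

-- r 0, …, r (k ∸ 1) is a simple (k,k)₁ Heffter system of ℤ_p with a single block, listed in an order
-- whose partial sums are distinct.
record BaseSequence (k : ℕ) : Set where
  p : ℕ
  p = 2 * k + 1
  instance
    p-nonZero : NonZero p
    p-nonZero = 2k+1-nonZero k
  field
    r : ℕ → ℕ
    r-positive : ∀ {i} → i < k → 0 < r i
    r<p : ∀ {i} → i < k → r i < p
    r-injective : ∀ {i j} → i < k → j < k → r i ≡ r j → i ≡ j
    r-±-surjective : ∀ {v} → 0 < v → v < p → ∃ λ i → i < k × r i ≡± v mod p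
    p∣sum : p ∣ sum (applyUpTo r k)
    partialSums-injective : ∀ {i j} → i < k → j < k →
      sum (applyUpTo r (suc i)) % p ≡ sum (applyUpTo r (suc j)) % p → i ≡ j

-- k nonzero residues meeting all k classes {v, p ∸ v} meet each class once, by pigeonhole on classIndex.
module ClassCover (k : ℕ) (r : ℕ → ℕ)
  (r-positive : ∀ {i} → i < k → 0 < r i) (r<p : ∀ {i} → i < k → r i < 2 * k + 1)
  (cover : ∀ {v} → 0 < v → v ≤ k → ∃ λ i → i < k × r i ≡± v mod 2 * k + 1) where

  p : ℕ
  p = 2 * k + 1

  instance
    p-nonZero : NonZero p
    p-nonZero = 2k+1-nonZero k

  class : ℕ → ℕ
  class x with x ≤? k
  ... | yes _ = x
  ... | no _ = p ∸ x

  p∸-bounds : ∀ {x} → k < x → x < p → 0 < p ∸ x × p ∸ x ≤ k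
  p∸-bounds {x} k<x x<p = m<n⇒0<n∸m x<p , m≤n+o⇒m∸n≤o p x (begin
    2 * k + 1   ≡⟨ solve 1 (λ k → con 2 :* k :+ con 1 := con 1 :+ k :+ k) refl k ⟩
    suc k + k   ≤⟨ +-monoˡ-≤ k k<x ⟩
    x + k ∎)
    where open ≤-Reasoning

  class-bounds : ∀ {x} → 0 < x → x < p → 0 < class x × class x ≤ k
  class-bounds {x} 0<x x<p with x ≤? k
  ... | yes x≤k = 0<x , x≤k
  ... | no x≰k = p∸-bounds (≰⇒> x≰k) x<p

  class-hit : ∀ {x v} → v ≤ k → x ≡± v mod p → class x ≡ v
  class-hit {x} v≤k (inj₁ refl) with x ≤? k
  ... | yes _ = refl
  ... | no x≰k = ⊥-elim (x≰k v≤k)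
  class-hit {x} {v} v≤k (inj₂ x+v≡p) with x ≤? k
  ... | yes x≤k = ⊥-elim (<-irrefl x+v≡p (begin-strict
    x + v        ≤⟨ +-mono-≤ x≤k v≤k ⟩
    k + k        <⟨ n<1+n (k + k) ⟩
    suc (k + k)  ≡⟨ solve 1 (λ k → con 1 :+ (k :+ k) := con 2 :* k :+ con 1) refl k ⟩
    p ∎))
    where open ≤-Reasoning
  ... | no _ = trans (cong (_∸ x) (sym x+v≡p)) (m+n∸m≡n x v)

  classIndex : Fin k → Fin k
  classIndex i = fromℕ< (pred<k (class-bounds (r-positive i<k) (r<p i<k)))
    where
    i<k : toℕ i < k
    i<k = Finₚ.toℕ<n i
    pred<k : ∀ {c} → 0 < c × c ≤ k → pred c < k
    pred<k (s≤s z≤n , c≤k) = c≤k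

  toℕ-classIndex : ∀ {i} (i<k : i < k) → toℕ (classIndex (fromℕ< i<k)) ≡ pred (class (r i))
  toℕ-classIndex {i} i<k = trans (Finₚ.toℕ-fromℕ< _) (cong (λ j → pred (class (r j))) (Finₚ.toℕ-fromℕ< i<k))

  classIndex-surjective : StrictlySurjective _≡_ classIndex
  classIndex-surjective v with i , i<k , hit ← cover {suc (toℕ v)} (s≤s z≤n) (Finₚ.toℕ<n v) =
    fromℕ< i<k , Finₚ.toℕ-injective (trans (toℕ-classIndex i<k) (cong pred (class-hit (Finₚ.toℕ<n v) hit)))

  r-injective : ∀ {i j} → i < k → j < k → r i ≡ r j → i ≡ j
  r-injective {i} {j} i<k j<k ri≡rj = begin
    i                  ≡⟨ sym (Finₚ.toℕ-fromℕ< i<k) ⟩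
    toℕ (fromℕ< i<k)   ≡⟨ cong toℕ (surjective⇒injective classIndex-surjective same-class) ⟩
    toℕ (fromℕ< j<k)   ≡⟨ Finₚ.toℕ-fromℕ< j<k ⟩
    j ∎
    where
    open ≡-Reasoning
    same-class : classIndex (fromℕ< i<k) ≡ classIndex (fromℕ< j<k)
    same-class = Finₚ.toℕ-injective (trans (toℕ-classIndex i<k)
      (trans (cong (pred ∘ class) ri≡rj) (sym (toℕ-classIndex j<k))))

  r-±-surjective : ∀ {v} → 0 < v → v < p → ∃ λ i → i < k × r i ≡± v mod p
  r-±-surjective {v} 0<v v<p with v ≤? k
  ... | yes v≤k = cover 0<v v≤k
  ... | no v≰k with 0<p∸v , p∸v≤k ← p∸-bounds (≰⇒> v≰k) v<p with cover 0<p∸v p∸v≤k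
  ...   | i , i<k , inj₁ ri≡p∸v = i , i<k , inj₂ (trans (cong (_+ v) ri≡p∸v) (m∸n+n≡m (<⇒≤ v<p)))
  ...   | i , i<k , inj₂ ri+p∸v≡p =
    i , i<k , inj₁ (+-cancelʳ-≡ (p ∸ v) (r i) v (trans ri+p∸v≡p (sym (m+[n∸m]≡n (<⇒≤ v<p)))))

-- `element` lists the steps 1, −(2m + e_m) (1 ≤ m ≤ s), 2m + 1 + e_m (1 ≤ m < s) and s + e_s of the
-- walk 1, −(1 + e₁), 2, −(2 + e₂), …, s, −(s + e_s), 0 through ℤ_p traced by `partial`, e_m = shift m.
module Walk (s′ T δ : ℕ) (δ≤ : δ ≤ suc (suc s′)) where

  s k p : ℕ
  s = suc s′
  k = suc (double s)
  p = 2 * k + 1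

  instance
    p-nonZero : NonZero p
    p-nonZero = 2k+1-nonZero k

  shift : ℕ → ℕ
  shift m with m ≤? T
  ... | yes _ = 0
  ... | no _ = δ

  up down : ℕ → ℕ
  up m = suc (double m) + shift m
  down m = p ∸ (double m + shift m)

  last : ℕ
  last = s + shift s

  evenElement : ℕ → ℕ
  evenElement zero = 1
  evenElement (suc m) with suc m <? s
  ... | yes _ = up (suc m)
  ... | no _ = last

  oddElement : ℕ → ℕ
  oddElement m = down (suc m)

  element : ℕ → ℕ
  element = interleave evenElement oddElement

  evenPartial : ℕ → ℕ
  evenPartial m with m <? s
  ... | yes _ = suc m
  ... | no _ = 0

  oddPartial : ℕ → ℕ
  oddPartial m = p ∸ (suc m + shift (suc m))

  partial : ℕ → ℕ
  partial = interleave evenPartial oddPartial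

  shift≤δ : ∀ m → shift m ≤ δ
  shift≤δ m with m ≤? T
  ... | yes _ = z≤n
  ... | no _ = ≤-refl

  shift-low : ∀ {m} → m ≤ T → shift m ≡ 0
  shift-low {m} m≤T with m ≤? T
  ... | yes _ = refl
  ... | no m≰T = ⊥-elim (m≰T m≤T)

  shift-high : ∀ {m} → T < m → shift m ≡ δ
  shift-high {m} T<m with m ≤? T
  ... | yes m≤T = ⊥-elim (<⇒≱ T<m m≤T)
  ... | no _ = refl

  shift-mono : ∀ {m m′} → m ≤ m′ → shift m ≤ shift m′
  shift-mono {m} {m′} m≤m′ with m′ ≤? T
  ... | yes m′≤T = ≤-reflexive (shift-low (≤-trans m≤m′ m′≤T))
  ... | no _ = shift≤δ m

  double-s+δ<p : double s + δ < p
  double-s+δ<p = begin-strict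
    double s + δ                    ≤⟨ +-monoʳ-≤ (double s) δ≤ ⟩
    double s + suc s                <⟨ s≤s (m≤m+n (double s + suc s) (suc s)) ⟩
    suc (double s + suc s + suc s)  ≡⟨ cong (λ d → suc (d + suc s + suc s)) (double≡+ s) ⟩
    suc (s + s + suc s + suc s)     ≡⟨ solve 1 (λ s → con 1 :+ (s :+ s :+ (con 1 :+ s) :+ (con 1 :+ s))
                                                  := con 2 :* (con 1 :+ (s :+ s)) :+ con 1) refl s ⟩
    2 * suc (s + s) + 1             ≡⟨ cong (λ d → 2 * suc d + 1) (sym (double≡+ s)) ⟩
    p ∎
    where open ≤-Reasoning

  double-m+shift<p : ∀ {m} → m ≤ s → double m + shift m < p
  double-m+shift<p {m} m≤s = ≤-<-trans (+-mono-≤ (double-mono-≤ m≤s) (shift≤δ m)) double-s+δ<p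

  m+shift<p : ∀ {m} → m ≤ s → m + shift m < p
  m+shift<p {m} m≤s = ≤-<-trans (+-monoˡ-≤ (shift m) (m≤double m)) (double-m+shift<p m≤s)

  s+m+shift<p : ∀ {m} → m ≤ s → s + (m + shift m) < p
  s+m+shift<p {m} m≤s = ≤-<-trans (begin
    s + (m + shift m)  ≤⟨ +-monoʳ-≤ s (+-mono-≤ m≤s (shift≤δ m)) ⟩
    s + (s + δ)        ≡⟨ sym (+-assoc s s δ) ⟩
    s + s + δ          ≡⟨ cong (_+ δ) (sym (double≡+ s)) ⟩
    double s + δ ∎) double-s+δ<p
    where open ≤-Reasoning

  up<p : ∀ {m} → m < s → up m < p
  up<p {m} m<s = ≤-<-trans (+-mono-≤ (double-mono-< m<s) (shift-mono (<⇒≤ m<s))) (double-m+shift<p ≤-refl)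

  element-double : ∀ m → element (double m) ≡ evenElement m
  element-double = interleave-even evenElement oddElement

  element-down : ∀ m → element (suc (double m)) ≡ down (suc m)
  element-down = interleave-odd evenElement oddElement

  element-up : ∀ {m} → 0 < m → m < s → element (double m) ≡ up m
  element-up {suc m} _ sm<s = trans (element-double (suc m)) evenElement-up
    where
    evenElement-up : evenElement (suc m) ≡ up (suc m)
    evenElement-up with suc m <? s
    ... | yes _ = refl
    ... | no sm≮s = ⊥-elim (sm≮s sm<s)

  element-last : element (double s) ≡ last
  element-last = trans (element-double s) evenElement-last
    where
    evenElement-last : evenElement s ≡ last
    evenElement-last with s <? s
    ... | yes s<s = ⊥-elim (<-irrefl refl s<s)
    ... | no _ = refl

  partial-double : ∀ m → partial (double m) ≡ evenPartial m
  partial-double = interleave-even evenPartial oddPartial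

  partial-odd : ∀ m → partial (suc (double m)) ≡ oddPartial m
  partial-odd = interleave-odd evenPartial oddPartial

  partial-even : ∀ {m} → m < s → partial (double m) ≡ suc m
  partial-even {m} m<s = trans (partial-double m) evenPartial-low
    where
    evenPartial-low : evenPartial m ≡ suc m
    evenPartial-low with m <? s
    ... | yes _ = refl
    ... | no m≮s = ⊥-elim (m≮s m<s)

  partial-last : partial (double s) ≡ 0
  partial-last = trans (partial-double s) evenPartial-last
    where
    evenPartial-last : evenPartial s ≡ 0
    evenPartial-last with s <? s
    ... | yes s<s = ⊥-elim (<-irrefl refl s<s)
    ... | no _ = refl

  down-step : ∀ {m} → m ≤ s → m + down m ≡ p ∸ (m + shift m)
  down-step {m} m≤s = sym (m+n≡o⇒o∸m≡n {m + shift m} (begin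
    m + shift m + (m + down m)   ≡⟨ solve 3 (λ m e d → m :+ e :+ (m :+ d) := m :+ m :+ e :+ d) refl m (shift m) (down m) ⟩
    m + m + shift m + down m     ≡⟨ cong (λ d → d + shift m + down m) (sym (double≡+ m)) ⟩
    double m + shift m + down m  ≡⟨ m+[n∸m]≡n (<⇒≤ (double-m+shift<p m≤s)) ⟩
    p ∎))
    where open ≡-Reasoning

  up-step : ∀ {m} → m ≤ s → (p ∸ (m + shift m)) + up m ≡ suc m + p
  up-step {m} m≤s = begin
    (p ∸ (m + shift m)) + (suc (double m) + shift m)
      ≡⟨ cong (λ d → (p ∸ (m + shift m)) + (suc d + shift m)) (double≡+ m) ⟩
    (p ∸ (m + shift m)) + (suc (m + m) + shift m)
      ≡⟨ solve 3 (λ d m e → d :+ (con 1 :+ (m :+ m) :+ e) := (m :+ e :+ d) :+ (con 1 :+ m))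
                 refl (p ∸ (m + shift m)) m (shift m) ⟩
    (m + shift m + (p ∸ (m + shift m))) + suc m
      ≡⟨ cong (_+ suc m) (m+[n∸m]≡n (<⇒≤ (m+shift<p m≤s))) ⟩
    p + suc m
      ≡⟨ +-comm p (suc m) ⟩
    suc m + p ∎
    where open ≡-Reasoning

  last-step : (p ∸ last) + last ≡ p
  last-step = m∸n+n≡m (<⇒≤ (m+shift<p ≤-refl))

  step : ∀ i → suc i < k → (partial i + element (suc i)) % p ≡ partial (suc i)
  step i si<k with parity i
  ... | even m = begin
    (partial (double m) + element (suc (double m))) % p
      ≡⟨ cong₂ (λ a b → (a + b) % p) (partial-even m<s) (element-down m) ⟩
    (suc m + down (suc m)) % p
      ≡⟨ cong (_% p) (down-step m<s) ⟩
    oddPartial m % p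
      ≡⟨ m<n⇒m%n≡m (∸-monoʳ-< (s≤s z≤n) (<⇒≤ (m+shift<p m<s))) ⟩
    oddPartial m
      ≡⟨ sym (partial-odd m) ⟩
    partial (suc (double m)) ∎
    where
    open ≡-Reasoning
    m<s : m < s
    m<s = double-cancel-< (≤-pred si<k)
  ... | odd m with suc m <? s
  ...   | yes sm<s = begin
    (partial (suc (double m)) + element (double (suc m))) % p
      ≡⟨ cong₂ (λ a b → (a + b) % p) (partial-odd m) (element-up (s≤s z≤n) sm<s) ⟩
    (oddPartial m + up (suc m)) % p
      ≡⟨ cong (_% p) (up-step (<⇒≤ sm<s)) ⟩
    (suc (suc m) + p) % p
      ≡⟨ [m+n]%n≡m%n (suc (suc m)) p ⟩
    suc (suc m) % p
      ≡⟨ m<n⇒m%n≡m (≤-<-trans sm<s (≤-<-trans (m≤m+n s (shift s)) (m+shift<p ≤-refl))) ⟩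
    suc (suc m)
      ≡⟨ sym (partial-even sm<s) ⟩
    partial (double (suc m)) ∎
    where open ≡-Reasoning
  ...   | no sm≮s with refl ← ≤-antisym (double-cancel-≤ (≤-pred si<k)) (≮⇒≥ sm≮s) = begin
    (partial (suc (double s′)) + element (double s)) % p
      ≡⟨ cong₂ (λ a b → (a + b) % p) (partial-odd s′) element-last ⟩
    (oddPartial s′ + last) % p
      ≡⟨ cong (_% p) last-step ⟩
    p % p
      ≡⟨ n%n≡0 p ⟩
    0
      ≡⟨ sym partial-last ⟩
    partial (double s) ∎
    where open ≡-Reasoning

  partialSum : ∀ {i} → i < k → sum (applyUpTo element (suc i)) % p ≡ partial i
  partialSum {zero} _ = trans (m<n⇒m%n≡m (≤-<-trans (s≤s z≤n) (m+shift<p ≤-refl))) (sym (partial-even (s≤s z≤n)))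
  partialSum {suc i} si<k = begin
    sum (applyUpTo element (suc (suc i))) % p
      ≡⟨ cong (_% p) (sum-applyUpTo-suc element (suc i)) ⟩
    (sum (applyUpTo element (suc i)) + element (suc i)) % p
      ≡⟨ sym ([m%d+n]%d≡[m+n]%d (sum (applyUpTo element (suc i))) (element (suc i)) p) ⟩
    (sum (applyUpTo element (suc i)) % p + element (suc i)) % p
      ≡⟨ cong (λ x → (x + element (suc i)) % p) (partialSum (<-trans (n<1+n i) si<k)) ⟩
    (partial i + element (suc i)) % p
      ≡⟨ step i si<k ⟩
    partial (suc i) ∎
    where open ≡-Reasoning

  p∣sum : p ∣ sum (applyUpTo element k)
  p∣sum = m%n≡0⇒n∣m _ p (trans (partialSum (n<1+n (double s))) partial-last)

  evenPartial≤s : ∀ m → evenPartial m ≤ s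
  evenPartial≤s m with m <? s
  ... | yes m<s = m<s
  ... | no _ = z≤n

  evenPartial-injective : ∀ {a b} → a ≤ s → b ≤ s → evenPartial a ≡ evenPartial b → a ≡ b
  evenPartial-injective {a} {b} a≤s b≤s eq with a <? s | b <? s
  ... | yes _ | yes _ = suc-injective eq
  ... | yes _ | no _ = ⊥-elim (1+n≢0 eq)
  ... | no _ | yes _ = ⊥-elim (1+n≢0 (sym eq))
  ... | no a≮s | no b≮s = trans (≤-antisym a≤s (≮⇒≥ a≮s)) (sym (≤-antisym b≤s (≮⇒≥ b≮s)))

  s<oddPartial : ∀ {m} → m < s → s < oddPartial m
  s<oddPartial m<s = m+n≤o⇒m≤o∸n (suc s) (s+m+shift<p m<s)

  oddPartial-injective : ∀ {a b} → a < s → b < s → oddPartial a ≡ oddPartial b → a ≡ b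
  oddPartial-injective {a} {b} a<s b<s eq =
    suc-injective (strictlyIncreasing⇒injective increasing
      (∸-cancelˡ-≡ (<⇒≤ (m+shift<p a<s)) (<⇒≤ (m+shift<p b<s)) eq))
    where
    increasing : ∀ {x y} → x < y → x + shift x < y + shift y
    increasing x<y = +-mono-<-≤ x<y (shift-mono (<⇒≤ x<y))

  partial-even≢odd : ∀ a b → b < s → partial (double a) ≢ partial (suc (double b))
  partial-even≢odd a b b<s eq = <⇒≱ (s<oddPartial b<s)
    (subst (_≤ s) (trans (sym (partial-double a)) (trans eq (partial-odd b))) (evenPartial≤s a))

  partial-injective : ∀ {i j} → i < k → j < k → partial i ≡ partial j → i ≡ j
  partial-injective {i} {j} i<k j<k eq with parity i | parity j
  ... | even a | even b = cong double (evenPartial-injective (double-cancel-≤ (≤-pred i<k)) (double-cancel-≤ (≤-pred j<k))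
    (trans (sym (partial-double a)) (trans eq (partial-double b))))
  ... | even a | odd b = ⊥-elim (partial-even≢odd a b (double-cancel-< (≤-pred j<k)) eq)
  ... | odd a | even b = ⊥-elim (partial-even≢odd b a (double-cancel-< (≤-pred i<k)) (sym eq))
  ... | odd a | odd b = cong (suc ∘ double) (oddPartial-injective (double-cancel-< (≤-pred i<k)) (double-cancel-< (≤-pred j<k))
    (trans (sym (partial-odd a)) (trans eq (partial-odd b))))

  element-bounds : ∀ {i} → i < k → 0 < element i × element i < p
  element-bounds {i} i<k with parity i
  ... | even m = subst (λ x → 0 < x × x < p) (sym (element-double m)) (evenElement-bounds m)
    where
    evenElement-bounds : ∀ m → 0 < evenElement m × evenElement m < p
    evenElement-bounds zero = s≤s z≤n , ≤-<-trans (s≤s z≤n) (m+shift<p ≤-refl)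
    evenElement-bounds (suc m) with suc m <? s
    ... | yes sm<s = s≤s z≤n , up<p sm<s
    ... | no _ = s≤s z≤n , m+shift<p ≤-refl
  ... | odd m = subst (λ x → 0 < x × x < p) (sym (element-down m))
    (m<n⇒0<n∸m (double-m+shift<p m<s) , ∸-monoʳ-< (s≤s z≤n) (<⇒≤ (double-m+shift<p m<s)))
    where
    m<s : suc m ≤ s
    m<s = double-cancel-< (≤-pred i<k)

  Covered : ℕ → Set
  Covered v = ∃ λ i → i < k × element i ≡± v mod p

  covered-by : ∀ {i x v} → i < k → element i ≡ x → x ≡± v mod p → Covered v
  covered-by {i} {x} {v} i<k e hit = i , i<k , Sum.map (trans e) (trans (cong (_+ v) e)) hit

  start-hit : Covered 1
  start-hit = 0 , s≤s z≤n , inj₁ refl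

  up-hit : ∀ {m v} → 0 < m → m < s → up m ≡± v mod p → Covered v
  up-hit 0<m m<s = covered-by (s≤s (double-mono-≤ (<⇒≤ m<s))) (element-up 0<m m<s)

  down-hit : ∀ {m v} → m < s → double (suc m) + shift (suc m) ≡± v mod p → Covered v
  down-hit {m} m<s hit =
    covered-by (s≤s (double-mono-< m<s)) (element-down m) (≡±-complement (<⇒≤ (double-m+shift<p m<s)) hit)

  last-hit : ∀ {v} → last ≡± v mod p → Covered v
  last-hit = covered-by ≤-refl element-last

  baseSequence : (∀ {v} → 0 < v → v ≤ k → Covered v) → BaseSequence k
  baseSequence cover = record
    { r = element
    ; r-positive = proj₁ ∘ element-bounds
    ; r<p = proj₂ ∘ element-bounds
    ; r-injective = ClassCover.r-injective k element (proj₁ ∘ element-bounds) (proj₂ ∘ element-bounds) cover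
    ; r-±-surjective = ClassCover.r-±-surjective k element (proj₁ ∘ element-bounds) (proj₂ ∘ element-bounds) cover
    ; p∣sum = p∣sum
    ; partialSums-injective = λ i<k j<k eq →
        partial-injective i<k j<k (trans (sym (partialSum i<k)) (trans eq (partialSum j<k)))
    }

module Cover-k≡3[mod4] (T : ℕ) where
  open Walk (double T) T 1 (s≤s z≤n)

  cover : ∀ {v} → 0 < v → v ≤ k → Covered v
  cover {v} 0<v v≤k with parity v
  ... | odd zero = start-hit
  ... | odd (suc m) with suc m ≤? T
  ...   | yes sm≤T = up-hit (s≤s z≤n) (s≤s (≤-trans sm≤T (m≤double T)))
    (inj₁ (trans (cong (suc (double (suc m)) +_) (shift-low sm≤T)) (+-identityʳ _)))
  ...   | no sm≰T = down-hit (double-cancel-≤ (≤-pred v≤k))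
    (inj₁ (trans (cong (double (suc m) +_) (shift-high (≰⇒> sm≰T))) (+-comm _ 1)))
  cover {v} 0<v v≤k | even (suc m) with <-cmp m T
  ... | tri< m<T _ _ = down-hit (<-trans m<T (s≤s (m≤double T)))
    (inj₁ (trans (cong (double (suc m) +_) (shift-low m<T)) (+-identityʳ _)))
  ... | tri≈ _ refl _ = last-hit (inj₁ (trans (cong (s +_) (shift-high (s≤s (m≤double T)))) (+-comm s 1)))
  ... | tri> _ _ T<m = up-hit (≤-<-trans z≤n T<m) (≤-pred (double-cancel-< (s≤s v≤k)))
    (inj₁ (trans (cong (suc (double m) +_) (shift-high T<m)) (+-comm _ 1)))

-- Beyond the threshold the classes are met in reverse order, whence the reflected indices.
module Cover-k≡1[mod4] (T : ℕ) where
  open Walk (suc (double T)) (suc T) (suc (suc (suc (double T)))) ≤-refl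

  T<s : suc T < s
  T<s = s≤s (s≤s (m≤double T))

  p≡ : p ≡ 8 * T + 11
  p≡ = begin
    2 * suc (double s) + 1
      ≡⟨ cong (λ d → 2 * suc d + 1) (double≡+ s) ⟩
    2 * suc (s + s) + 1
      ≡⟨ cong (λ d → 2 * suc (suc (suc d) + suc (suc d)) + 1) (double≡+ T) ⟩
    2 * suc (suc (suc (T + T)) + suc (suc (T + T))) + 1
      ≡⟨ solve 1 (λ t → con 2 :* (con 1 :+ ((con 2 :+ (t :+ t)) :+ (con 2 :+ (t :+ t)))) :+ con 1
                     := con 8 :* t :+ con 11) refl T ⟩
    8 * T + 11 ∎
    where open ≡-Reasoning

  mirror-up : ∀ {a b} → suc T < b → a + b ≡ suc (suc T + suc (double T)) → up b + suc (double a) ≡ p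
  mirror-up {a} {b} T<b a+b≡ = begin
    suc (double b) + shift b + suc (double a)
      ≡⟨ cong (λ e → suc (double b) + e + suc (double a)) (shift-high T<b) ⟩
    suc (double b) + suc (suc (suc (double T))) + suc (double a)
      ≡⟨ cong₂ (λ x y → suc x + suc (suc (suc (double T))) + suc y) (double≡+ b) (double≡+ a) ⟩
    suc (b + b) + suc (suc (suc (double T))) + suc (a + a)
      ≡⟨ solve 3 (λ a b d → con 1 :+ (b :+ b) :+ (con 3 :+ d) :+ (con 1 :+ (a :+ a))
                         := (a :+ b) :+ (a :+ b) :+ (con 5 :+ d)) refl a b (double T) ⟩
    (a + b) + (a + b) + (5 + double T)
      ≡⟨ cong (λ x → x + x + (5 + double T)) a+b≡ ⟩
    suc (suc T + suc (double T)) + suc (suc T + suc (double T)) + (5 + double T)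
      ≡⟨ cong (λ d → suc (suc T + suc d) + suc (suc T + suc d) + (5 + d)) (double≡+ T) ⟩
    suc (suc T + suc (T + T)) + suc (suc T + suc (T + T)) + (5 + (T + T))
      ≡⟨ solve 1 (λ t → con 1 :+ (con 1 :+ t :+ (con 1 :+ (t :+ t)))
                     :+ (con 1 :+ (con 1 :+ t :+ (con 1 :+ (t :+ t)))) :+ (con 5 :+ (t :+ t))
                     := con 8 :* t :+ con 11) refl T ⟩
    8 * T + 11
      ≡⟨ sym p≡ ⟩
    p ∎
    where open ≡-Reasoning

  mirror-down : ∀ {a b} → suc T < b → a + b ≡ suc (suc T + s) → double b + shift b + double a ≡ p
  mirror-down {a} {b} T<b a+b≡ = begin
    double b + shift b + double a
      ≡⟨ cong (λ e → double b + e + double a) (shift-high T<b) ⟩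
    double b + suc (suc (suc (double T))) + double a
      ≡⟨ cong₂ (λ x y → x + suc (suc (suc (double T))) + y) (double≡+ b) (double≡+ a) ⟩
    b + b + suc (suc (suc (double T))) + (a + a)
      ≡⟨ solve 3 (λ a b d → b :+ b :+ (con 3 :+ d) :+ (a :+ a)
                         := (a :+ b) :+ (a :+ b) :+ (con 3 :+ d)) refl a b (double T) ⟩
    (a + b) + (a + b) + (3 + double T)
      ≡⟨ cong (λ x → x + x + (3 + double T)) a+b≡ ⟩
    suc (suc T + suc (suc (double T))) + suc (suc T + suc (suc (double T))) + (3 + double T)
      ≡⟨ cong (λ d → suc (suc T + suc (suc d)) + suc (suc T + suc (suc d)) + (3 + d)) (double≡+ T) ⟩
    suc (suc T + suc (suc (T + T))) + suc (suc T + suc (suc (T + T))) + (3 + (T + T))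
      ≡⟨ solve 1 (λ t → con 1 :+ (con 1 :+ t :+ (con 2 :+ (t :+ t)))
                     :+ (con 1 :+ (con 1 :+ t :+ (con 2 :+ (t :+ t)))) :+ (con 3 :+ (t :+ t))
                     := con 8 :* t :+ con 11) refl T ⟩
    8 * T + 11
      ≡⟨ sym p≡ ⟩
    p ∎
    where open ≡-Reasoning

  last≡k : last ≡ k
  last≡k = begin
    s + shift s   ≡⟨ cong (s +_) (shift-high T<s) ⟩
    s + suc s     ≡⟨ +-suc s s ⟩
    suc (s + s)   ≡⟨ cong suc (sym (double≡+ s)) ⟩
    k ∎
    where open ≡-Reasoning

  cover : ∀ {v} → 0 < v → v ≤ k → Covered v
  cover {v} 0<v v≤k with parity v
  ... | odd zero = start-hit
  ... | odd (suc m) with suc m ≤? suc T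
  ...   | yes sm≤T = up-hit (s≤s z≤n) (≤-<-trans sm≤T T<s)
    (inj₁ (trans (cong (suc (double (suc m)) +_) (shift-low sm≤T)) (+-identityʳ _)))
  ...   | no sm≰T with m≤n⇒m<n∨m≡n (double-cancel-≤ (≤-pred v≤k))
  ...     | inj₂ refl = last-hit (inj₁ last≡k)
  ...     | inj₁ sm<s with m″ , T<m″ , m″<s , sm+m″≡ ← reflect-in-interval (≰⇒> sm≰T) (≤-pred sm<s) =
    up-hit (≤-<-trans z≤n T<m″) (s≤s m″<s) (inj₂ (mirror-up T<m″ sm+m″≡))
  cover {v} 0<v v≤k | even (suc m) with suc m ≤? suc T
  ... | yes sm≤T = down-hit (<⇒≤ (≤-<-trans sm≤T T<s))
    (inj₁ (trans (cong (double (suc m) +_) (shift-low sm≤T)) (+-identityʳ _)))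
  ... | no sm≰T
    with suc m′ , s≤s T≤m′ , m′<s , sm+m′≡ ← reflect-in-interval (≰⇒> sm≰T) (≤-pred (double-cancel-< (s≤s v≤k))) =
    down-hit m′<s (inj₂ (mirror-down (s≤s T≤m′) sm+m′≡))

baseSequence : ∀ j → BaseSequence (3 + double j)
baseSequence j with parity j
... | even T = Walk.baseSequence (double T) T 1 (s≤s z≤n) (Cover-k≡3[mod4].cover T)
... | odd T = Walk.baseSequence (suc (double T)) (suc T) (suc (suc (suc (double T)))) ≤-refl (Cover-k≡1[mod4].cover T)

-- An element of ℤ_(n p) is written p a + ρ with a < n and ρ < p (`combine`).  This is no isomorphism
-- ℤ_(n p) ≅ ℤ_n × ℤ_p (n and p need not be coprime): the residues of a block sum to carry · p, which
-- goes into the first coordinate.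
module Lift (n′ j : ℕ) (oddn : Odd (suc n′)) (B : BaseSequence (3 + double j)) where

  open BaseSequence B
  n k : ℕ
  n = suc n′
  k = 3 + double j
  open Cyclic n k oddn

  carry : ℕ
  carry = sum (applyUpTo r k) / p

  -- Modulo n the coefficients are 2, −1, −1, 1, −1, 1, −1, …: units (n is odd) whose k first terms sum
  -- to 0.  So q ↦ cell t q i is a bijection of ℤ_n, and the offsets t and −(t + carry) make the
  -- coordinates of every block sum to −carry.
  pairCoefficient : ℕ → ℕ
  pairCoefficient zero = 1
  pairCoefficient (suc zero) = n′
  pairCoefficient (suc (suc i)) = pairCoefficient i

  coefficient : ℕ → ℕ
  coefficient zero = 2
  coefficient (suc zero) = n′
  coefficient (suc (suc zero)) = n′
  coefficient (suc (suc (suc i))) = pairCoefficient i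

  offset : ℕ → ℕ → ℕ
  offset t (suc zero) = t
  offset t (suc (suc zero)) = n′ * (t + carry)
  offset t _ = 0

  coordinate : ℕ → Fin n → ℕ → ℕ
  coordinate t q i = toℕ q * coefficient i + offset t i

  cell : ℕ → Fin n → ℕ → Fin n
  cell t q i = coordinate t q i mod n

  residue : ℕ → Fin p
  residue i = r i mod p

  element : ℕ → Fin n → ℕ → G
  element t q i = combine (cell t q i) (residue i)

  block : ℕ → Fin n → List G
  block t q = applyUpTo (element t q) k

  toℕ-residue : ∀ {i} → i < k → toℕ (residue i) ≡ r i
  toℕ-residue {i} i<k = trans (toℕ-mod (r i) p) (m<n⇒m%n≡m (r<p i<k))

  toℕ-element : ∀ t q {i} → i < k → toℕ (element t q i) ≡ p * (coordinate t q i % n) + r i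
  toℕ-element t q {i} i<k = trans (Finₚ.toℕ-combine (cell t q i) (residue i))
    (cong₂ (λ a b → p * a + b) (toℕ-mod (coordinate t q i) n) (toℕ-residue i<k))

  pairCoefficient-coprime : ∀ i → Coprime n (pairCoefficient i)
  pairCoefficient-coprime zero = Coprimality.sym (1-coprimeTo n)
  pairCoefficient-coprime (suc zero) = coprime-pred n′
  pairCoefficient-coprime (suc (suc i)) = pairCoefficient-coprime i

  coefficient-coprime : ∀ i → Coprime n (coefficient i)
  coefficient-coprime zero = odd⇒coprime-2 oddn
  coefficient-coprime (suc zero) = coprime-pred n′
  coefficient-coprime (suc (suc zero)) = coprime-pred n′
  coefficient-coprime (suc (suc (suc i))) = pairCoefficient-coprime i

  cell-injective : ∀ t i → Injective _≡_ _≡_ (λ q → cell t q i)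
  cell-injective t i {q} {q′} eq = Finₚ.toℕ-injective
    ([x*c+a]%n-injective (offset t i) (coefficient-coprime i) (Finₚ.toℕ<n q) (Finₚ.toℕ<n q′)
      (trans (sym (toℕ-mod (coordinate t q i) n)) (trans (cong toℕ eq) (toℕ-mod (coordinate t q′ i) n))))

  cell-surjective : ∀ t i → StrictlySurjective _≡_ (λ q → cell t q i)
  cell-surjective t i = injective⇒surjective (cell-injective t i)

  element-injective : ∀ {t t′ q q′ i i′} → i < k → i′ < k → element t q i ≡ element t′ q′ i′ →
    i ≡ i′ × cell t q i ≡ cell t′ q′ i′
  element-injective {t} {t′} {q} {q′} {i} {i′} i<k i′<k eq
    with cells , residues ← Finₚ.combine-injective (cell t q i) (residue i) (cell t′ q′ i′) (residue i′) eq =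
    r-injective i<k i′<k (trans (sym (toℕ-residue i<k)) (trans (cong toℕ residues) (toℕ-residue i′<k))) , cells

  sum-pairCoefficients : ∀ m → sum (applyUpTo pairCoefficient (double m)) ≡ m * n
  sum-pairCoefficients zero = refl
  sum-pairCoefficients (suc m) = cong (λ x → suc (n′ + x)) (sum-pairCoefficients m)

  sum-coefficients : sum (applyUpTo coefficient k) ≡ suc (suc j) * n
  sum-coefficients = trans (cong (λ x → 2 + (n′ + (n′ + x))) (sum-pairCoefficients j))
    (solve 2 (λ n j → con 2 :+ (n :+ (n :+ j :* (con 1 :+ n))) := (con 2 :+ j) :* (con 1 :+ n)) refl n′ j)

  sum-offsets : ∀ t → sum (applyUpTo (offset t) k) ≡ t + n′ * (t + carry)
  sum-offsets t = trans (cong (λ x → t + (n′ * (t + carry) + x)) (sum-applyUpTo-0 (double j))) (cong (t +_) (+-identityʳ _))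

  coordinates-sum : ∀ t q → sum (applyUpTo (coordinate t q) k) + carry ≡ n * (toℕ q * suc (suc j) + (t + carry))
  coordinates-sum t q = begin
    sum (applyUpTo (coordinate t q) k) + carry
      ≡⟨ cong (_+ carry) (sum-applyUpTo-linear (toℕ q) coefficient (offset t) k) ⟩
    toℕ q * sum (applyUpTo coefficient k) + sum (applyUpTo (offset t) k) + carry
      ≡⟨ cong₂ (λ a b → toℕ q * a + b + carry) sum-coefficients (sum-offsets t) ⟩
    toℕ q * (suc (suc j) * n) + (t + n′ * (t + carry)) + carry
      ≡⟨ solve 5 (λ x j m t d → x :* ((con 2 :+ j) :* (con 1 :+ m)) :+ (t :+ m :* (t :+ d)) :+ d
                              := (con 1 :+ m) :* (x :* (con 2 :+ j) :+ (t :+ d))) refl (toℕ q) j n′ t carry ⟩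
    n * (toℕ q * suc (suc j) + (t + carry)) ∎
    where open ≡-Reasoning

  sum-elements : ∀ t q {m} → m ≤ k →
    sum (applyUpTo (toℕ ∘ element t q) m) ≡ p * sum (applyUpTo (λ i → coordinate t q i % n) m) + sum (applyUpTo r m)
  sum-elements t q {m} m≤k =
    trans (cong sum (applyUpTo-cong m (λ i<m → toℕ-element t q (<-≤-trans i<m m≤k))))
          (sum-applyUpTo-linear p (λ i → coordinate t q i % n) r m)

  n∣reduced-coordinates+carry : ∀ t q → n ∣ sum (applyUpTo (λ i → coordinate t q i % n) k) + carry
  n∣reduced-coordinates+carry t q = m%n≡0⇒n∣m _ n (begin
    (C + carry) % n
      ≡⟨ sym ([m%d+n]%d≡[m+n]%d C carry n) ⟩
    (C % n + carry) % n
      ≡⟨ cong (λ x → (x + carry) % n) (sum-applyUpTo-% (coordinate t q) k n) ⟩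
    (sum (applyUpTo (coordinate t q) k) % n + carry) % n
      ≡⟨ [m%d+n]%d≡[m+n]%d (sum (applyUpTo (coordinate t q) k)) carry n ⟩
    (sum (applyUpTo (coordinate t q) k) + carry) % n
      ≡⟨ cong (_% n) (trans (coordinates-sum t q) (*-comm n _)) ⟩
    ((toℕ q * suc (suc j) + (t + carry)) * n) % n
      ≡⟨ m*n%n≡0 (toℕ q * suc (suc j) + (t + carry)) n ⟩
    0 ∎)
    where
    open ≡-Reasoning
    C : ℕ
    C = sum (applyUpTo (λ i → coordinate t q i % n) k)

  block-sum : ∀ t q → sum (map toℕ (block t q)) % N ≡ 0
  block-sum t q = begin
    sum (map toℕ (block t q)) % N
      ≡⟨ cong (λ xs → sum xs % N) (Listₚ.map-applyUpTo (element t q) toℕ k) ⟩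
    sum (applyUpTo (toℕ ∘ element t q) k) % N
      ≡⟨ cong (_% N) (sum-elements t q ≤-refl) ⟩
    (p * C + sum (applyUpTo r k)) % N
      ≡⟨ cong (λ x → (p * C + x) % N) (sym (m/n*n≡m p∣sum)) ⟩
    (p * C + carry * p) % N
      ≡⟨ cong (_% N) (solve 3 (λ p c d → p :* c :+ d :* p := p :* (c :+ d)) refl p C carry) ⟩
    (p * (C + carry)) % N
      ≡⟨ cong (λ x → (p * x) % N) (sym (m/n*n≡m (n∣reduced-coordinates+carry t q))) ⟩
    (p * ((C + carry) / n * n)) % N
      ≡⟨ cong (_% N) (solve 3 (λ p w n → p :* (w :* n) := w :* (n :* p)) refl p ((C + carry) / n) n) ⟩
    ((C + carry) / n * N) % N
      ≡⟨ m*n%n≡0 ((C + carry) / n) N ⟩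
    0 ∎
    where
    open ≡-Reasoning
    C : ℕ
    C = sum (applyUpTo (λ i → coordinate t q i % n) k)

  block-unique : ∀ t q → Unique (block t q)
  block-unique t q = Uniqueₚ.applyUpTo⁺₁ (element t q) k
    (λ i<i′ i′<k eq → <-irrefl (proj₁ (element-injective {t} {t} {q} {q} (<-trans i<i′ i′<k) i′<k eq)) i<i′)

  partialSums-applyUpTo : ∀ acc (f : ℕ → G) m →
    partialSums acc (applyUpTo f m) ≡ applyUpTo (λ i → (acc + sum (applyUpTo (toℕ ∘ f) (suc i))) % N) m
  partialSums-applyUpTo acc f zero = refl
  partialSums-applyUpTo acc f (suc m) = cong₂ _∷_
    (cong (λ x → (acc + x) % N) (sym (+-identityʳ (toℕ (f 0)))))
    (trans (partialSums-applyUpTo (acc + toℕ (f 0)) (f ∘ suc) m)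
           (applyUpTo-cong m (λ _ → cong (_% N) (+-assoc acc (toℕ (f 0)) _))))

  p∣N : p ∣ N
  p∣N = n∣m*n n

  prefixSum : ℕ → Fin n → ℕ → ℕ
  prefixSum t q i = (0 + sum (applyUpTo (toℕ ∘ element t q) (suc i))) % N

  prefixSum-residue : ∀ t q {i} → i < k → prefixSum t q i % p ≡ sum (applyUpTo r (suc i)) % p
  prefixSum-residue t q {i} i<k = begin
    sum (applyUpTo (toℕ ∘ element t q) (suc i)) % N % p
      ≡⟨ m∣n⇒o%n%m≡o%m p N (sum (applyUpTo (toℕ ∘ element t q) (suc i))) p∣N ⟩
    sum (applyUpTo (toℕ ∘ element t q) (suc i)) % p
      ≡⟨ cong (_% p) (sum-elements t q i<k) ⟩
    (p * C + sum (applyUpTo r (suc i))) % p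
      ≡⟨ cong (_% p) (+-comm (p * C) _) ⟩
    (sum (applyUpTo r (suc i)) + p * C) % p
      ≡⟨ %-remove-+ʳ (sum (applyUpTo r (suc i))) (m∣m*n C) ⟩
    sum (applyUpTo r (suc i)) % p ∎
    where
    open ≡-Reasoning
    C : ℕ
    C = sum (applyUpTo (λ i → coordinate t q i % n) (suc i))

  prefixSum-injective : ∀ t q {i i′} → i < k → i′ < k → prefixSum t q i ≡ prefixSum t q i′ → i ≡ i′
  prefixSum-injective t q i<k i′<k eq = partialSums-injective i<k i′<k
    (trans (sym (prefixSum-residue t q i<k)) (trans (cong (_% p) eq) (prefixSum-residue t q i′<k)))

  partialSums-unique : ∀ t q → Unique (partialSums 0 (block t q))
  partialSums-unique t q = subst Unique (sym (partialSums-applyUpTo 0 (element t q) k))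
    (Uniqueₚ.applyUpTo⁺₁ (prefixSum t q) k
      (λ i<i′ i′<k eq → <-irrefl (prefixSum-injective t q (<-trans i<i′ i′<k) i′<k eq) i<i′))

  block-simple : ∀ t q → IsSimple (fromList (block t q))
  block-simple t q = block t q , block-unique t q ,
    (λ x → mk⇔ (Equivalence.from (∈-fromList (block t q))) (Equivalence.to (∈-fromList (block t q)))) ,
    partialSums-unique t q

  ∈-block⁻ : ∀ {t q x} → x ∈ block t q → ∃ λ i → i < k × x ≡ element t q i
  ∈-block⁻ {t} {q} = ∈ₚ.∈-applyUpTo⁻ (element t q)

  same-block : ∀ {t q q′ x} → x ∈ block t q → x ∈ block t q′ → q ≡ q′
  same-block {t} {q} {q′} x∈ x∈′
    with i , i<k , x≡ ← ∈-block⁻ {t} {q} x∈ | i′ , i′<k , x≡′ ← ∈-block⁻ {t} {q′} x∈′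
    with refl , cells ← element-injective {t} {t} {q} {q′} i<k i′<k (trans (sym x≡) x≡′) =
    cell-injective t i cells

  support : ℕ → List G
  support t = concat (map (block t) (allFin n))

  ∈-support⁺ : ∀ {t q x} → x ∈ block t q → x ∈ support t
  ∈-support⁺ {t} {q} x∈ = ∈ₚ.∈-concat⁺′ x∈ (∈ₚ.∈-map⁺ (block t) (∈ₚ.∈-allFin q))

  ∈-support⁻ : ∀ {t x} → x ∈ support t → ∃ λ q → x ∈ block t q
  ∈-support⁻ {t} x∈ with xs , x∈xs , xs∈ ← ∈ₚ.∈-concat⁻′ (map (block t) (allFin n)) x∈
    with q , _ , refl ← ∈ₚ.∈-map⁻ (block t) {xs = allFin n} xs∈ = q , x∈xs

  element∈support : ∀ {t q i} → i < k → element t q i ∈ support t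
  element∈support {t} {q} i<k = ∈-support⁺ {t} {q} (∈ₚ.∈-applyUpTo⁺ (element t q) i<k)

  support-unique : ∀ t → Unique (support t)
  support-unique t = Uniqueₚ.concat⁺ (Allₚ.map⁺ (All.universal (block-unique t) (allFin n)))
    (AllPairsₚ.map⁺ (AllPairs.map (λ {q} {q′} q≢q′ {_} (x∈ , x∈′) → q≢q′ (same-block {t} {q} {q′} x∈ x∈′))
                                  (Uniqueₚ.allFin⁺ n)))

  support-length : ∀ t → length (support t) ≡ n * k
  support-length t = trans (length-concat-map (block t) (λ q → Listₚ.length-applyUpTo (element t q) k) (allFin n))
    (cong (_* k) (Listₚ.length-tabulate {n = n} (λ q → q)))

  negℕ-combine : ∀ (a : Fin n) (ρ : Fin p) → 0 < toℕ ρ → negℕ (combine a ρ) ≡ p * toℕ (opposite a) + (p ∸ toℕ ρ)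
  negℕ-combine a ρ 0<ρ = begin
    (N ∸ toℕ (combine a ρ)) % N       ≡⟨ cong (λ x → (N ∸ x) % N) (Finₚ.toℕ-combine a ρ) ⟩
    (N ∸ (p * toℕ a + toℕ ρ)) % N     ≡⟨ cong (_% N) (m+n≡o⇒o∸m≡n {p * toℕ a + toℕ ρ} complement) ⟩
    (p * w + (p ∸ toℕ ρ)) % N         ≡⟨ m<n⇒m%n≡m bounded ⟩
    p * w + (p ∸ toℕ ρ)               ≡⟨ cong (λ x → p * x + (p ∸ toℕ ρ)) (sym (Finₚ.opposite-prop a)) ⟩
    p * toℕ (opposite a) + (p ∸ toℕ ρ) ∎
    where
    open ≡-Reasoning
    w : ℕ
    w = n′ ∸ toℕ a
    complement : p * toℕ a + toℕ ρ + (p * w + (p ∸ toℕ ρ)) ≡ N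
    complement = begin
      p * toℕ a + toℕ ρ + (p * w + (p ∸ toℕ ρ))
        ≡⟨ solve 5 (λ p a ρ w d → p :* a :+ ρ :+ (p :* w :+ d) := p :* (a :+ w) :+ (ρ :+ d)) refl p (toℕ a) (toℕ ρ) w (p ∸ toℕ ρ) ⟩
      p * (toℕ a + w) + (toℕ ρ + (p ∸ toℕ ρ))
        ≡⟨ cong₂ (λ x y → p * x + y) (m+[n∸m]≡n (≤-pred (Finₚ.toℕ<n a))) (m+[n∸m]≡n (<⇒≤ (Finₚ.toℕ<n ρ))) ⟩
      p * n′ + p
        ≡⟨ solve 2 (λ p m → p :* m :+ p := (con 1 :+ m) :* p) refl p n′ ⟩
      N ∎
    bounded : p * w + (p ∸ toℕ ρ) < N
    bounded = <-≤-trans (+-monoʳ-< (p * w) (∸-monoʳ-< 0<ρ (<⇒≤ (Finₚ.toℕ<n ρ))))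
      (≤-trans (+-monoˡ-≤ p (*-monoʳ-≤ p (m∸n≤m n′ (toℕ a))))
               (≤-reflexive (solve 2 (λ p m → p :* m :+ p := (con 1 :+ m) :* p) refl p n′)))

  element∉J : ∀ t q {i} → i < k → ¬ InJ (element t q i)
  element∉J t q {i} i<k p∣element = <⇒≱ (r<p i<k) (∣⇒≤ {{>-nonZero (r-positive i<k)}}
    (∣m+n∣m⇒∣n (subst (p ∣_) (toℕ-element t q i<k) p∣element) (m∣m*n (coordinate t q i % n))))

  support∉J : ∀ t {x} → x ∈ support t → ¬ InJ x
  support∉J t x∈ with q , x∈block ← ∈-support⁻ {t} x∈ with i , i<k , refl ← ∈-block⁻ {t} {q} x∈block =
    element∉J t q i<k

  InJ⇒p∣negℕ : ∀ x → InJ x → p ∣ negℕ x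
  InJ⇒p∣negℕ x p∣x = m%n≡0⇒n∣m _ p (trans (m∣n⇒o%n%m≡o%m p N (N ∸ toℕ x) p∣N) (n∣m⇒m%n≡0 _ p p∣N∸x))
    where
    p∣N∸x : p ∣ N ∸ toℕ x
    p∣N∸x = ∣m+n∣m⇒∣n (subst (p ∣_) (sym (m+[n∸m]≡n (<⇒≤ (Finₚ.toℕ<n x)))) p∣N) p∣x

  supportSet : ℕ → Subset N
  supportSet t = fromList (support t)

  ∉J⇒residue-positive : ∀ (a : Fin n) (ρ : Fin p) → ¬ InJ (combine a ρ) → 0 < toℕ ρ
  ∉J⇒residue-positive a ρ ∉J = n≢0⇒n>0 λ ρ≡0 →
    ∉J (subst (p ∣_) (sym (trans (Finₚ.toℕ-combine a ρ) (trans (cong (p * toℕ a +_) ρ≡0) (+-identityʳ _))))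
               (m∣m*n (toℕ a)))

  combine∈supportSet : ∀ t {i} → i < k → ∀ (a : Fin n) (ρ : Fin p) → r i ≡ toℕ ρ → combine a ρ ∈ˢ supportSet t
  combine∈supportSet t {i} i<k a ρ ri≡ρ =
    Equivalence.from (∈-fromList (support t)) (subst (_∈ support t) element≡ (element∈support {t} {q} i<k))
    where
    q : Fin n
    q = proj₁ (cell-surjective t i a)
    cell≡a : cell t q i ≡ a
    cell≡a = proj₂ (cell-surjective t i a)
    residue≡ρ : residue i ≡ ρ
    residue≡ρ = Finₚ.toℕ-injective (trans (toℕ-residue i<k) ri≡ρ)
    element≡ : element t q i ≡ combine a ρ
    element≡ = cong₂ combine cell≡a residue≡ρ

  negℕ-combine∈supportSet : ∀ t {i} → i < k → ∀ (a : Fin n) (ρ : Fin p) → 0 < toℕ ρ → r i + toℕ ρ ≡ p →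
    negℕ (combine a ρ) ∈ᴺ supportSet t
  negℕ-combine∈supportSet t {i} i<k a ρ 0<ρ ri+ρ≡p =
    element t q i , toℕ-element≡ , Equivalence.from (∈-fromList (support t)) (element∈support {t} {q} i<k)
    where
    q : Fin n
    q = proj₁ (cell-surjective t i (opposite a))
    cell≡ā : cell t q i ≡ opposite a
    cell≡ā = proj₂ (cell-surjective t i (opposite a))
    toℕ-element≡ : toℕ (element t q i) ≡ negℕ (combine a ρ)
    toℕ-element≡ = begin
      toℕ (element t q i)                     ≡⟨ Finₚ.toℕ-combine (cell t q i) (residue i) ⟩
      p * toℕ (cell t q i) + toℕ (residue i)  ≡⟨ cong₂ (λ x y → p * toℕ x + y) cell≡ā (toℕ-residue i<k) ⟩
      p * toℕ (opposite a) + r i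
        ≡⟨ cong (p * toℕ (opposite a) +_) (sym (m+n≡o⇒o∸m≡n (trans (+-comm (toℕ ρ) (r i)) ri+ρ≡p))) ⟩
      p * toℕ (opposite a) + (p ∸ toℕ ρ)      ≡⟨ sym (negℕ-combine a ρ 0<ρ) ⟩
      negℕ (combine a ρ) ∎
      where open ≡-Reasoning

  ∉J⇒covered : ∀ t x → ¬ InJ x → (x ∈ˢ supportSet t) ⊎ (negℕ x ∈ᴺ supportSet t)
  ∉J⇒covered t x x∉J with a , ρ , a,ρ≡x ← Finₚ.combine-surjective {n} {p} x =
    subst (λ y → (y ∈ˢ supportSet t) ⊎ (negℕ y ∈ᴺ supportSet t)) a,ρ≡x (covered (r-±-surjective 0<ρ (Finₚ.toℕ<n ρ)))
    where
    0<ρ : 0 < toℕ ρ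
    0<ρ = ∉J⇒residue-positive a ρ (subst (¬_ ∘ InJ) (sym a,ρ≡x) x∉J)
    covered : (∃ λ i → i < k × r i ≡± toℕ ρ mod p) →
              (combine a ρ ∈ˢ supportSet t) ⊎ (negℕ (combine a ρ) ∈ᴺ supportSet t)
    covered (i , i<k , inj₁ ri≡ρ) = inj₁ (combine∈supportSet t i<k a ρ ri≡ρ)
    covered (i , i<k , inj₂ ri+ρ≡p) = inj₂ (negℕ-combine∈supportSet t i<k a ρ 0<ρ ri+ρ≡p)

  covered⇒∉J : ∀ t x → (x ∈ˢ supportSet t) ⊎ (negℕ x ∈ᴺ supportSet t) → ¬ InJ x
  covered⇒∉J t x (inj₁ x∈V) = support∉J t (Equivalence.to (∈-fromList (support t)) x∈V)
  covered⇒∉J t x (inj₂ (y , y≡negx , y∈V)) x∈J =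
    support∉J t (Equivalence.to (∈-fromList (support t)) y∈V) (subst (p ∣_) (sym y≡negx) (InJ⇒p∣negℕ x x∈J))

  supportSet-halfSet : ∀ t → IsHalfSet (supportSet t)
  supportSet-halfSet t = trans (∣fromList∣ (support-unique t)) (support-length t) ,
    λ x → mk⇔ (∉J⇒covered t x) (covered⇒∉J t x)

  blocks-of : ℕ → List (Subset N)
  blocks-of t = map (fromList ∘ block t) (allFin n)

  blockwise : ∀ {t} {P : Subset N → Set} → (∀ q → P (fromList (block t q))) → ∀ B → B ∈ blocks-of t → P B
  blockwise {P = P} h B = All.lookup {P = P} (Allₚ.map⁺ (All.universal h (allFin n)))

  ∈-blocks-of⁻ : ∀ {t B} → B ∈ blocks-of t → ∃ λ q → B ≡ fromList (block t q)
  ∈-blocks-of⁻ {t} B∈ = map₂ proj₂ (∈ₚ.∈-map⁻ (fromList ∘ block t) {xs = allFin n} B∈)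

  block∈blocks-of : ∀ t q → fromList (block t q) ∈ blocks-of t
  block∈blocks-of t q = ∈ₚ.∈-map⁺ (fromList ∘ block t) (∈ₚ.∈-allFin q)

  block-size : ∀ t q → ∣ fromList (block t q) ∣ ≡ k
  block-size t q = trans (∣fromList∣ (block-unique t q)) (Listₚ.length-applyUpTo (element t q) k)

  block-zero-sum : ∀ t q → subsetSum (fromList (block t q)) ≡ 0
  block-zero-sum t q = trans (cong (_% N) (sumOver-fromList toℕ (block-unique t q))) (block-sum t q)

  block⊆supportSet : ∀ t q x → x ∈ˢ fromList (block t q) → x ∈ˢ supportSet t
  block⊆supportSet t q x x∈ =
    Equivalence.from (∈-fromList (support t)) (∈-support⁺ {t} {q} (Equivalence.to (∈-fromList (block t q)) x∈))

  blocks-cover : ∀ t x → x ∈ˢ supportSet t → ∃ λ B → B ∈ blocks-of t × x ∈ˢ B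
  blocks-cover t x x∈ = fromList (block t q) , block∈blocks-of t q , Equivalence.from (∈-fromList (block t q)) x∈block
    where
    q : Fin n
    q = proj₁ (∈-support⁻ {t} (Equivalence.to (∈-fromList (support t)) x∈))
    x∈block : x ∈ block t q
    x∈block = proj₂ (∈-support⁻ {t} (Equivalence.to (∈-fromList (support t)) x∈))

  blocks-disjoint : ∀ t B C → B ∈ blocks-of t → C ∈ blocks-of t → ∀ x → x ∈ˢ B → x ∈ˢ C → B ≡ C
  blocks-disjoint t B C B∈ C∈ x x∈B x∈C = trans B≡ (trans (cong (fromList ∘ block t) q≡q′) (sym C≡))
    where
    q q′ : Fin n
    q = proj₁ (∈-blocks-of⁻ B∈)
    q′ = proj₁ (∈-blocks-of⁻ C∈)
    B≡ : B ≡ fromList (block t q)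
    B≡ = proj₂ (∈-blocks-of⁻ B∈)
    C≡ : C ≡ fromList (block t q′)
    C≡ = proj₂ (∈-blocks-of⁻ C∈)
    q≡q′ : q ≡ q′
    q≡q′ = same-block {t} {q} {q′} (Equivalence.to (∈-fromList (block t q)) (subst (x ∈ˢ_) B≡ x∈B))
                                    (Equivalence.to (∈-fromList (block t q′)) (subst (x ∈ˢ_) C≡ x∈C))

  system : ℕ → RelHeffter
  system t = record
    { V = supportSet t
    ; halfSet = supportSet-halfSet t
    ; blocks = blocks-of t
    ; blockSize = blockwise (block-size t)
    ; blockSum = blockwise (block-zero-sum t)
    ; covers = blocks-cover t
    ; inside = blockwise (block⊆supportSet t)
    ; disjoint = blocks-disjoint t
    }

  system-simple : ∀ t → IsSimpleSystem (system t)
  system-simple t = blockwise (block-simple t)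

  -- Every system has combine 0 (r 0) in its block 0, whose element 1 has coordinate t.
  shared-block : ∀ {t t′} → SameSystem (system t) (system t′) → element t Fin.zero 1 ∈ block t′ Fin.zero
  shared-block {t} {t′} same = Equivalence.to (∈-fromList (block t′ Fin.zero)) (subst (element t Fin.zero 1 ∈ˢ_) B₀≡C₀
      (Equivalence.from (∈-fromList (block t Fin.zero)) (∈ₚ.∈-applyUpTo⁺ (element t Fin.zero) (s≤s (s≤s z≤n)))))
    where
    B₀ C₀ : Subset N
    B₀ = fromList (block t Fin.zero)
    C₀ = fromList (block t′ Fin.zero)
    B₀≡C₀ : B₀ ≡ C₀
    B₀≡C₀ = blocks-disjoint t′ B₀ C₀ (Equivalence.to (same B₀) (block∈blocks-of t Fin.zero)) (block∈blocks-of t′ Fin.zero)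
      (element t Fin.zero 0)
      (Equivalence.from (∈-fromList (block t Fin.zero)) (∈ₚ.∈-applyUpTo⁺ (element t Fin.zero) (s≤s z≤n)))
      (Equivalence.from (∈-fromList (block t′ Fin.zero)) (∈ₚ.∈-applyUpTo⁺ (element t′ Fin.zero) (s≤s z≤n)))

  systems-distinct : ∀ {t t′} → t < n → t′ < n → t ≢ t′ → Distinct (system t) (system t′)
  systems-distinct {t} {t′} t<n t′<n t≢t′ same = t≢t′ (begin
      t                        ≡⟨ sym (m<n⇒m%n≡m t<n) ⟩
      t % n                    ≡⟨ sym (toℕ-mod t n) ⟩
      toℕ (cell t Fin.zero 1)  ≡⟨ cong toℕ cells ⟩
      toℕ (cell t′ Fin.zero 1) ≡⟨ toℕ-mod t′ n ⟩
      t′ % n                   ≡⟨ m<n⇒m%n≡m t′<n ⟩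
      t′ ∎)
    where
    open ≡-Reasoning
    hit : ∃ λ i′ → i′ < k × element t Fin.zero 1 ≡ element t′ Fin.zero i′
    hit = ∈-block⁻ {t′} {Fin.zero} (shared-block same)
    matched : 1 ≡ proj₁ hit × cell t Fin.zero 1 ≡ cell t′ Fin.zero (proj₁ hit)
    matched = element-injective {t} {t′} {Fin.zero} {Fin.zero} (s≤s (s≤s z≤n)) (proj₁ (proj₂ hit)) (proj₂ (proj₂ hit))
    cells : cell t Fin.zero 1 ≡ cell t′ Fin.zero 1
    cells = subst (λ i → cell t Fin.zero 1 ≡ cell t′ Fin.zero i) (sym (proj₁ matched)) (proj₂ matched)

  systems : List RelHeffter
  systems = applyUpTo system n

  systems-length : length systems ≡ n
  systems-length = Listₚ.length-applyUpTo system n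

  systems-simple : All.All IsSimpleSystem systems
  systems-simple = Allₚ.applyUpTo⁺₁ system n (λ {t} _ → system-simple t)

  systems-pairwise-distinct : AllPairs.AllPairs Distinct systems
  systems-pairwise-distinct = AllPairsₚ.applyUpTo⁺₁ system n
    (λ t<t′ t′<n → systems-distinct (<-trans t<t′ t′<n) t′<n (<⇒≢ t<t′))

proposition3p1 : (n k : ℕ) → (oddn : Odd n) → 3 ≤ k → k ∣ n →
    ∃ λ (Hs : List (Cyclic.RelHeffter n k oddn)) →
      (φ k + 1 ≤ length Hs)
      × All (Cyclic.IsSimpleSystem n k oddn) Hs
      × AllPairs (Cyclic.Distinct n k oddn) Hs
proposition3p1 zero k oddn _ _ = ⊥-elim (oddn (2 ∣0))
proposition3p1 (suc n′) k oddn 3≤k k∣n with j , refl ← odd⇒3+double 3≤k (λ 2∣k → oddn (∣-trans 2∣k k∣n)) =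
  systems , enough , systems-simple , systems-pairwise-distinct
  where
  open Lift n′ j oddn (baseSequence j) using (systems; systems-length; systems-simple; systems-pairwise-distinct)
  enough : φ (3 + double j) + 1 ≤ length systems
  enough = begin
    φ (3 + double j) + 1  ≡⟨ +-comm _ 1 ⟩
    suc (φ (3 + double j)) ≤⟨ φ<n (s≤s (s≤s z≤n)) ⟩
    3 + double j          ≤⟨ ∣⇒≤ k∣n ⟩
    suc n′                ≡⟨ sym systems-length ⟩
    length systems ∎
    where open ≤-Reasoning
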